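{- Let $f(n)=an^{2}+bn+c$ with $a,b,c\in\mathbb{Z}$, $a$ odd and $b$ even, and suppose $b^{2}-4ac=4\Delta$ with $\Delta\equiv m\pmod 8$, $m\in\{2,3,5,6,7\}$. Then for $n\in\mathbb{N}$: \begin{itemize} \item If $m\in\{3,7\}$ and $b\equiv 0\pmod 4$, or $m\in\{2,6\}$ and $b\equiv 2\pmod 4$, then $\nu_2(f(n))=0$ for $n$ even and $\nu_2(f(n))=1$ for $n$ odd. \item If $m\in\{2,6\}$ and $b\equiv 0\pmod 4$, or $m\in\{3,7\}$ and $b\equiv 2\pmod 4$, then $\nu_2(f(n))=1$ for $n$ even and $\nu_2(f(n))=0$ for $n$ odd. \item If $m=5$ and $b\equiv 0\pmod 4$, then $\nu_2(f(n))=0$ for $n$ even and $\nu_2(f(n))=2$ for $n$ odd. \item If $m=5$ and $b\equiv 2\pmod 4$, then $\nu_2(f(n))=2$ for $n$ even and $\nu_2(f(n))=0$ for $n$ odd. \end{itemize}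
   Context: $\nu_2(x)$ denotes the exponent of the highest power of $2$ dividing a nonzero integer $x$; $\mathbb{N}=\{0,1,2,\ldots\}$. -}

module Defs where

open import Data.Nat as ℕ using (ℕ; suc)
import Data.Nat.Divisibility as ℕD
open import Data.Integer using (ℤ; +_; _+_; _*_; _-_)
open import Data.Integer.Divisibility using (_∣_)
open import Data.Product using (_×_)
open import Relation.Nullary using (¬_)

quad : ℤ → ℤ → ℤ → ℕ → ℤ
quad a b c n = a * (+ n) * (+ n) + b * (+ n) + c

infix 4 _≡_[mod_]
_≡_[mod_] : ℤ → ℤ → ℕ → Set
x ≡ r [mod d ] = + d ∣ (x - r)

-- ν₂(x) = k, i.e. 2^k divides x but 2^(k+1) does not (forces x ≠ 0)
ν₂≡ : ℤ → ℕ → Set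
ν₂≡ x k = (+ (2 ℕ.^ k) ∣ x) × ¬ (+ (2 ℕ.^ suc k) ∣ x)

ParityVal : (ℕ → ℤ) → ℕ → ℕ → Set
ParityVal f e o = ∀ (n : ℕ) → (2 ℕD.∣ n → ν₂≡ (f n) e) × (¬ (2 ℕD.∣ n) → ν₂≡ (f n) o)

-- Write b = 2β. Completing the square gives a·f(n) = t² − Δ with t = an + β, and a is
-- odd, so ν₂(f(n)) = ν₂(t² − Δ). Odd squares are 1 mod 8 and even squares 0 mod 4, so
-- t² − Δ ≡ 1 − m (mod 8) for odd t and t² − Δ ≡ −m (mod 4) for even t; these residues
-- already determine the valuation. Finally t has the parity of n + β, and β is even
-- exactly when b ≡ 0 (mod 4).
module Submission where

open import Defs
open import Data.Nat using (ℕ; suc)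
open import Data.Integer using (ℤ; +_; _+_; _*_; _-_; ∣_∣)
open import Data.Integer.Divisibility using (_∣_)
open import Data.Product using (_×_; _,_; ∃-syntax; proj₁; proj₂)
open import Data.Sum using (_⊎_; inj₁; inj₂)
open import Relation.Nullary using (¬_; Dec; _×-dec_; ¬?)
open import Relation.Binary.PropositionalEquality
  using (_≡_; refl; sym; trans; cong; subst; module ≡-Reasoning)

import Data.Nat as ℕ
import Data.Nat.Properties as ℕP
import Data.Nat.Divisibility as ℕD
open import Data.Nat.Primality using (euclidsLemma; prime[2])
open import Data.Integer.Properties using (abs-*; *-comm; +-comm; +-identityˡ; *-cancelˡ-≡)
import Data.Integer.Divisibility.Signed as S
open import Data.Integer.DivMod using (_%ℕ_; _/ℕ_; n%ℕd<d; a≡a%ℕn+[a/ℕn]*n)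
open import Data.Integer.Tactic.RingSolver using (solve; solve-∀)
open import Data.List using ([]; _∷_)
open import Data.Empty using (⊥-elim)
open import Function using (_∘_)
open import Relation.Nullary.Decidable using (True; toWitness)

^-monoʳ-∣ : ∀ b {m n} → m ℕ.≤ n → b ℕ.^ m ℕD.∣ b ℕ.^ n
^-monoʳ-∣ b {m} {n} m≤n = ℕD.divides (b ℕ.^ (n ℕ.∸ m)) (begin
  b ℕ.^ n                       ≡⟨ cong (b ℕ.^_) (ℕP.m+[n∸m]≡n m≤n) ⟨
  b ℕ.^ (m ℕ.+ (n ℕ.∸ m))       ≡⟨ ℕP.^-distribˡ-+-* b m (n ℕ.∸ m) ⟩
  b ℕ.^ m ℕ.* b ℕ.^ (n ℕ.∸ m)   ≡⟨ ℕP.*-comm (b ℕ.^ m) _ ⟩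
  b ℕ.^ (n ℕ.∸ m) ℕ.* b ℕ.^ m   ∎)
  where open ≡-Reasoning

2^∣odd*n⇒2^∣n : ∀ k {a n} → ¬ 2 ℕD.∣ a → 2 ℕ.^ k ℕD.∣ a ℕ.* n → 2 ℕ.^ k ℕD.∣ n
2^∣odd*n⇒2^∣n ℕ.zero _ _ = ℕD.1∣ _
2^∣odd*n⇒2^∣n (suc k) {a} {n} 2∤a 2^[1+k]∣an
  with euclidsLemma a n prime[2] (ℕD.∣-trans (ℕD.m∣m*n (2 ℕ.^ k)) 2^[1+k]∣an)
... | inj₁ 2∣a = ⊥-elim (2∤a 2∣a)
... | inj₂ (ℕD.divides y refl) = subst (2 ℕ.^ suc k ℕD.∣_) (ℕP.*-comm 2 y)
        (ℕD.*-monoʳ-∣ 2 (2^∣odd*n⇒2^∣n k 2∤a 2^k∣ay))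
  where
  a*[y*2]≡2*[a*y] : a ℕ.* (y ℕ.* 2) ≡ 2 ℕ.* (a ℕ.* y)
  a*[y*2]≡2*[a*y] = trans (sym (ℕP.*-assoc a y 2)) (ℕP.*-comm (a ℕ.* y) 2)
  2^k∣ay : 2 ℕ.^ k ℕD.∣ a ℕ.* y
  2^k∣ay = ℕD.*-cancelˡ-∣ 2 (subst (2 ℕ.^ suc k ℕD.∣_) a*[y*2]≡2*[a*y] 2^[1+k]∣an)

∣-by-quotient : ∀ k x q → x ≡ q * k → k ∣ x
∣-by-quotient k x q x≡q*k = S.∣⇒∣ᵤ {k} {x} (S.divides q x≡q*k)

≡-mod⇒quotient : ∀ {x r d} → x ≡ r [mod d ] → ∃[ q ] x ≡ q * + d + r
≡-mod⇒quotient {x} {r} {d} x≡r with S.∣ᵤ⇒∣ {+ d} {x - r} x≡r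
... | S.divides q x-r≡q*d = q , (begin
  x             ≡⟨ solve (x ∷ r ∷ []) ⟩
  (x - r) + r   ≡⟨ cong (_+ r) x-r≡q*d ⟩
  q * + d + r   ∎)
  where open ≡-Reasoning

≡-mod-sub : ∀ {x y r s d} → x ≡ r [mod d ] → y ≡ s [mod d ] → x - y ≡ r - s [mod d ]
≡-mod-sub {x} {y} {r} {s} {d} x≡r y≡s = S.∣⇒∣ᵤ (subst (+ d S.∣_) regroup
  (S.∣m∣n⇒∣m-n (S.∣ᵤ⇒∣ {i = x - r} x≡r) (S.∣ᵤ⇒∣ {i = y - s} y≡s)))
  where
  regroup : (x - r) - (y - s) ≡ (x - y) - (r - s)
  regroup = solve (x ∷ y ∷ r ∷ s ∷ [])

ν₂≡? : ∀ x k → Dec (ν₂≡ x k)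
ν₂≡? x k = (2 ℕ.^ k ℕD.∣? ∣ x ∣) ×-dec ¬? (2 ℕ.^ suc k ℕD.∣? ∣ x ∣)

ν₂≡-cancel-odd : ∀ {a x k} → ¬ (+ 2 ∣ a) → ν₂≡ (a * x) k → ν₂≡ x k
ν₂≡-cancel-odd {a} {x} {k} 2∤a (2^k∣ax , 2^[1+k]∤ax) =
    2^∣odd*n⇒2^∣n k 2∤a (subst (2 ℕ.^ k ℕD.∣_) (abs-* a x) 2^k∣ax)
  , λ 2^[1+k]∣x → 2^[1+k]∤ax
      (subst (2 ℕ.^ suc k ℕD.∣_) (sym (abs-* a x)) (ℕD.∣n⇒∣m*n ∣ a ∣ 2^[1+k]∣x))

ν₂≡-resp-mod : ∀ {x r k j} → k ℕ.< j → x ≡ r [mod 2 ℕ.^ j ] → ν₂≡ r k → ν₂≡ x k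
ν₂≡-resp-mod {x} {r} {k} k<j x≡r (2^k∣r , 2^[1+k]∤r) = 2^k∣x , 2^[1+k]∤x
  where
  2^[1+k]∣x-r : + (2 ℕ.^ suc k) S.∣ x - r
  2^[1+k]∣x-r = S.∣ᵤ⇒∣ (ℕD.∣-trans (^-monoʳ-∣ 2 k<j) x≡r)
  [x-r]+r≡x : (x - r) + r ≡ x
  [x-r]+r≡x = solve (x ∷ r ∷ [])
  x-[x-r]≡r : x - (x - r) ≡ r
  x-[x-r]≡r = solve (x ∷ r ∷ [])
  2^k∣x : + (2 ℕ.^ k) ∣ x
  2^k∣x = S.∣⇒∣ᵤ (subst (+ (2 ℕ.^ k) S.∣_) [x-r]+r≡x
    (S.∣m∣n⇒∣m+n (S.∣-trans (S.∣ᵤ⇒∣ (ℕD.n∣m*n 2)) 2^[1+k]∣x-r) (S.∣ᵤ⇒∣ {i = r} 2^k∣r)))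
  2^[1+k]∤x : ¬ (+ (2 ℕ.^ suc k) ∣ x)
  2^[1+k]∤x 2^[1+k]∣x = 2^[1+k]∤r (S.∣⇒∣ᵤ (subst (+ (2 ℕ.^ suc k) S.∣_) x-[x-r]≡r
    (S.∣m∣n⇒∣m-n (S.∣ᵤ⇒∣ {i = x} 2^[1+k]∣x) 2^[1+k]∣x-r)))

Even Odd : ℤ → Set
Even x = ∃[ q ] x ≡ + 2 * q
Odd x = ∃[ q ] x ≡ + 2 * q + + 1

even⊎odd : ∀ x → Even x ⊎ Odd x
even⊎odd x with x %ℕ 2 | n%ℕd<d x 2 | x /ℕ 2 | a≡a%ℕn+[a/ℕn]*n x 2
... | 0 | _ | q | x≡0+q*2 = inj₁ (q , trans x≡0+q*2 (trans (+-identityˡ _) (*-comm q (+ 2))))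
... | 1 | _ | q | x≡1+q*2 =
  inj₂ (q , trans x≡1+q*2 (trans (+-comm (+ 1) (q * + 2)) (cong (_+ + 1) (*-comm q (+ 2)))))
... | suc (suc _) | ℕ.s≤s (ℕ.s≤s ()) | _ | _

2∣⇒even : ∀ {x} → + 2 ∣ x → Even x
2∣⇒even {x} 2∣x with S.∣ᵤ⇒∣ {+ 2} {x} 2∣x
... | S.divides q x≡q*2 = q , trans x≡q*2 (*-comm q (+ 2))

¬2∣⇒odd : ∀ {x} → ¬ (+ 2 ∣ x) → Odd x
¬2∣⇒odd {x} 2∤x with even⊎odd x
... | inj₁ (q , x≡2q) = ⊥-elim (2∤x (∣-by-quotient (+ 2) x q (trans x≡2q (*-comm (+ 2) q))))
... | inj₂ x-odd = x-odd

*+-parity-even : ∀ a {x y} → Even x → (Even y → Even (a * x + y)) × (Odd y → Odd (a * x + y))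
*+-parity-even a (j , refl) = (λ { (q , refl) → a * j + q , even+even a j q })
                            , (λ { (q , refl) → a * j + q , even+odd a j q })
  where
  even+even : ∀ a j q → a * (+ 2 * j) + + 2 * q ≡ + 2 * (a * j + q)
  even+even = solve-∀
  even+odd : ∀ a j q → a * (+ 2 * j) + (+ 2 * q + + 1) ≡ + 2 * (a * j + q) + + 1
  even+odd = solve-∀

*+-parity-odd : ∀ {a x y} → Odd a → Odd x → (Even y → Odd (a * x + y)) × (Odd y → Even (a * x + y))
*+-parity-odd (z , refl) (j , refl) =
    (λ { (q , refl) → (+ 2 * z + + 1) * j + z + q , odd+even z j q })
  , (λ { (q , refl) → (+ 2 * z + + 1) * j + z + q + + 1 , odd+odd z j q })
  where
  odd+even : ∀ z j q → (+ 2 * z + + 1) * (+ 2 * j + + 1) + + 2 * q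
           ≡ + 2 * ((+ 2 * z + + 1) * j + z + q) + + 1
  odd+even = solve-∀
  odd+odd : ∀ z j q → (+ 2 * z + + 1) * (+ 2 * j + + 1) + (+ 2 * q + + 1)
          ≡ + 2 * ((+ 2 * z + + 1) * j + z + q + + 1)
  odd+odd = solve-∀

≡0-mod-4⇒twice-even : ∀ {b} → b ≡ + 0 [mod 4 ] → ∃[ β ] b ≡ + 2 * β × Even β
≡0-mod-4⇒twice-even b≡0 with ≡-mod⇒quotient b≡0
... | q , b≡4q = + 2 * q , trans b≡4q (regroup q) , q , refl
  where
  regroup : ∀ q → q * + 4 + + 0 ≡ + 2 * (+ 2 * q)
  regroup = solve-∀

≡2-mod-4⇒twice-odd : ∀ {b} → b ≡ + 2 [mod 4 ] → ∃[ β ] b ≡ + 2 * β × Odd β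
≡2-mod-4⇒twice-odd b≡2 with ≡-mod⇒quotient b≡2
... | q , b≡4q+2 = + 2 * q + + 1 , trans b≡4q+2 (regroup q) , q , refl
  where
  regroup : ∀ q → q * + 4 + + 2 ≡ + 2 * (+ 2 * q + + 1)
  regroup = solve-∀

odd²≡1-mod-8 : ∀ {t} → Odd t → t * t ≡ + 1 [mod 8 ]
odd²≡1-mod-8 {t} (s , refl) with even⊎odd s
... | inj₁ (p , refl) = ∣-by-quotient (+ 8) (t * t - + 1) (p * (+ 2 * p + + 1)) (expand p)
  where
  expand : ∀ p → let t = + 2 * (+ 2 * p) + + 1 in t * t - + 1 ≡ p * (+ 2 * p + + 1) * + 8
  expand = solve-∀
... | inj₂ (p , refl) = ∣-by-quotient (+ 8) (t * t - + 1) ((+ 2 * p + + 1) * (p + + 1)) (expand p)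
  where
  expand : ∀ p → let t = + 2 * (+ 2 * p + + 1) + + 1 in
           t * t - + 1 ≡ (+ 2 * p + + 1) * (p + + 1) * + 8
  expand = solve-∀

even²≡0-mod-4 : ∀ {t} → Even t → t * t ≡ + 0 [mod 4 ]
even²≡0-mod-4 {t} (s , refl) = ∣-by-quotient (+ 4) (t * t - + 0) (s * s) (expand s)
  where
  expand : ∀ s → + 2 * s * (+ 2 * s) - + 0 ≡ s * s * + 4
  expand = solve-∀

-- A record rather than a product of Π-types, so that e and o can be inferred from it.
record SquareSubVal (Δ : ℤ) (e o : ℕ) : Set where
  field
    at-even : ∀ {t} → Even t → ν₂≡ (t * t - Δ) e
    at-odd  : ∀ {t} → Odd t → ν₂≡ (t * t - Δ) o

squareSubVal : ∀ {Δ} m e o → Δ ≡ + m [mod 8 ] →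
  {_ : True (e ℕ.<? 2)} {_ : True (ν₂≡? (+ 0 - + m) e)} →
  {_ : True (o ℕ.<? 3)} {_ : True (ν₂≡? (+ 1 - + m) o)} →
  SquareSubVal Δ e o
squareSubVal {Δ} m e o Δ≡m {e<2} {ν₂-e} {o<3} {ν₂-o} =
  record { at-even = at-even ; at-odd = at-odd }
  where
  at-even : ∀ {t} → Even t → ν₂≡ (t * t - Δ) e
  at-even {t} t-even = ν₂≡-resp-mod {t * t - Δ} {+ 0 - + m} (toWitness e<2)
    (≡-mod-sub {t * t} {Δ} {+ 0} {+ m} (even²≡0-mod-4 t-even) (ℕD.∣-trans (ℕD.divides 2 refl) Δ≡m))
    (toWitness ν₂-e)
  at-odd : ∀ {t} → Odd t → ν₂≡ (t * t - Δ) o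
  at-odd {t} t-odd = ν₂≡-resp-mod {t * t - Δ} {+ 1 - + m} (toWitness o<3)
    (≡-mod-sub {t * t} {Δ} {+ 1} {+ m} (odd²≡1-mod-8 t-odd) Δ≡m) (toWitness ν₂-o)

squareSubVal-3,7 : ∀ {Δ m} → m ≡ 3 ⊎ m ≡ 7 → Δ ≡ + m [mod 8 ] → SquareSubVal Δ 0 1
squareSubVal-3,7 (inj₁ refl) Δ≡m = squareSubVal 3 0 1 Δ≡m
squareSubVal-3,7 (inj₂ refl) Δ≡m = squareSubVal 7 0 1 Δ≡m

squareSubVal-2,6 : ∀ {Δ m} → m ≡ 2 ⊎ m ≡ 6 → Δ ≡ + m [mod 8 ] → SquareSubVal Δ 1 0
squareSubVal-2,6 (inj₁ refl) Δ≡m = squareSubVal 2 1 0 Δ≡m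
squareSubVal-2,6 (inj₂ refl) Δ≡m = squareSubVal 6 1 0 Δ≡m

squareSubVal-5 : ∀ {Δ m} → m ≡ 5 → Δ ≡ + m [mod 8 ] → SquareSubVal Δ 0 2
squareSubVal-5 refl Δ≡m = squareSubVal 5 0 2 Δ≡m

complete-square : ∀ {a b c Δ β} x → b ≡ + 2 * β → b * b - + 4 * a * c ≡ + 4 * Δ →
  a * (a * x * x + b * x + c) ≡ (a * x + β) * (a * x + β) - Δ
complete-square {a} {b} {c} {Δ} {β} x refl disc = *-cancelˡ-≡ (+ 4) _ _ (begin
  + 4 * (a * (a * x * x + b * x + c))                         ≡⟨ expand a β c x ⟩
  + 4 * ((a * x + β) * (a * x + β)) - (b * b - + 4 * a * c)
    ≡⟨ cong (λ d → + 4 * ((a * x + β) * (a * x + β)) - d) disc ⟩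
  + 4 * ((a * x + β) * (a * x + β)) - + 4 * Δ                 ≡⟨ factor ((a * x + β) * (a * x + β)) Δ ⟩
  + 4 * ((a * x + β) * (a * x + β) - Δ)                       ∎)
  where
  open ≡-Reasoning
  expand : ∀ a β c x → + 4 * (a * (a * x * x + + 2 * β * x + c))
         ≡ + 4 * ((a * x + β) * (a * x + β)) - (+ 2 * β * (+ 2 * β) - + 4 * a * c)
  expand = solve-∀
  factor : ∀ u Δ → + 4 * u - + 4 * Δ ≡ + 4 * (u - Δ)
  factor = solve-∀

parityVal-quad : ∀ {a b c Δ e o} → ¬ (+ 2 ∣ a) → b * b - + 4 * a * c ≡ + 4 * Δ →
  SquareSubVal Δ e o →
  (b ≡ + 0 [mod 4 ] → ParityVal (quad a b c) e o) × (b ≡ + 2 [mod 4 ] → ParityVal (quad a b c) o e)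
parityVal-quad {a} {b} {c} {Δ} {e} {o} 2∤a disc values = β-even-case , β-odd-case
  where
  open SquareSubVal values
  a-odd : Odd a
  a-odd = ¬2∣⇒odd 2∤a
  ν₂-quad : ∀ {β} k → b ≡ + 2 * β → ∀ n →
    ν₂≡ ((a * + n + β) * (a * + n + β) - Δ) k → ν₂≡ (quad a b c n) k
  ν₂-quad {β} k b≡2β n = ν₂≡-cancel-odd {a} {quad a b c n} {k} 2∤a
    ∘ subst (λ v → ν₂≡ v k) (sym (complete-square {a} {b} {c} {Δ} {β} (+ n) b≡2β disc))
  β-even-case : b ≡ + 0 [mod 4 ] → ParityVal (quad a b c) e o
  β-even-case b≡0 n with ≡0-mod-4⇒twice-even b≡0
  ... | β , b≡2β , β-even =
      (λ 2∣n → ν₂-quad e b≡2β n (at-even (proj₁ (*+-parity-even a (2∣⇒even {+ n} 2∣n)) β-even)))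
    , (λ 2∤n → ν₂-quad o b≡2β n (at-odd (proj₁ (*+-parity-odd a-odd (¬2∣⇒odd {+ n} 2∤n)) β-even)))
  β-odd-case : b ≡ + 2 [mod 4 ] → ParityVal (quad a b c) o e
  β-odd-case b≡2 n with ≡2-mod-4⇒twice-odd b≡2
  ... | β , b≡2β , β-odd =
      (λ 2∣n → ν₂-quad o b≡2β n (at-odd (proj₂ (*+-parity-even a (2∣⇒even {+ n} 2∣n)) β-odd)))
    , (λ 2∤n → ν₂-quad e b≡2β n (at-even (proj₂ (*+-parity-odd a-odd (¬2∣⇒odd {+ n} 2∤n)) β-odd)))

lemma13 : (a b c Δ : ℤ) (m : ℕ) →
    ¬ (+ 2 ∣ a) → + 2 ∣ b →
    b * b - + 4 * a * c ≡ + 4 * Δ →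
    Δ ≡ + m [mod 8 ] →
    (m ≡ 2 ⊎ m ≡ 3 ⊎ m ≡ 5 ⊎ m ≡ 6 ⊎ m ≡ 7) →
    ((((m ≡ 3 ⊎ m ≡ 7) × (b ≡ + 0 [mod 4 ])) ⊎ ((m ≡ 2 ⊎ m ≡ 6) × (b ≡ + 2 [mod 4 ])))
        → ParityVal (quad a b c) 0 1)
    × ((((m ≡ 2 ⊎ m ≡ 6) × (b ≡ + 0 [mod 4 ])) ⊎ ((m ≡ 3 ⊎ m ≡ 7) × (b ≡ + 2 [mod 4 ])))
        → ParityVal (quad a b c) 1 0)
    × (((m ≡ 5) × (b ≡ + 0 [mod 4 ])) → ParityVal (quad a b c) 0 2)
    × (((m ≡ 5) × (b ≡ + 2 [mod 4 ])) → ParityVal (quad a b c) 2 0)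
lemma13 a b c Δ m 2∤a _ disc Δ≡m _ =
    (λ { (inj₁ (m∈37 , b≡0)) → proj₁ (values (squareSubVal-3,7 m∈37 Δ≡m)) b≡0
       ; (inj₂ (m∈26 , b≡2)) → proj₂ (values (squareSubVal-2,6 m∈26 Δ≡m)) b≡2 })
  , (λ { (inj₁ (m∈26 , b≡0)) → proj₁ (values (squareSubVal-2,6 m∈26 Δ≡m)) b≡0
       ; (inj₂ (m∈37 , b≡2)) → proj₂ (values (squareSubVal-3,7 m∈37 Δ≡m)) b≡2 })
  , (λ (m≡5 , b≡0) → proj₁ (values (squareSubVal-5 m≡5 Δ≡m)) b≡0)
  , (λ (m≡5 , b≡2) → proj₂ (values (squareSubVal-5 m≡5 Δ≡m)) b≡2)
  where
  -- The two ignored hypotheses (b even, m in range) are implied by each case's hypothesis.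
  values : ∀ {e o} → SquareSubVal Δ e o →
    (b ≡ + 0 [mod 4 ] → ParityVal (quad a b c) e o) × (b ≡ + 2 [mod 4 ] → ParityVal (quad a b c) o e)
  values = parityVal-quad {a} {b} {c} {Δ} 2∤a disc
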